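{- Let $\mathcal C_1,\mathcal C_2,\mathcal D$ be graph classes with $\mathcal D\sqsubseteq^\circ_{\mathrm{FO}}\mathcal C_1\cup\mathcal C_2$. Then there is a partition $\mathcal D=\mathcal D_1\cup\mathcal D_2$ with $\mathcal D_1\sqsubseteq^\circ_{\mathrm{FO}}\mathcal C_1$ and $\mathcal D_2\sqsubseteq^\circ_{\mathrm{FO}}\mathcal C_2$. The same statement holds with $\sqsubseteq_{\mathrm{FO}}$ in place of $\sqsubseteq^\circ_{\mathrm{FO}}$.
   Context: All graphs are finite, simple, undirected. A $\Sigma$-expansion of $G$ ($\Sigma$ a finite set of unary symbols) is $G$ with a subset of $V(G)$ for each symbol. A simple interpretation $(\nu(x),\eta(x,y))$ of first-order formulas over $\{E\}\cup\Sigma$ ($\eta$ symmetric, antireflexive) produces from $G^+$ the graph on $\nu(G^+)$ with edges $uv$ where $G^+\models\eta(u,v)$. A non-copying transduction is a pair $(\Sigma,\mathsf I)$, producing from $G$ all $\mathsf I(G^+)$. The $k$-copy operation maps $G$ to $k$ disjoint copies of $G$ with copies of each vertex made pairwise adjacent. A transduction is a finite composition of copy operations and non-copying transductions. $\mathcal C\sqsubseteq_{\mathrm{FO}}\mathcal D$ (resp. $\mathcal C\sqsubseteq^\circ_{\mathrm{FO}}\mathcal D$) means there is a transduction (resp. non-copying transduction) $\mathsf T$ such that every graph of $\mathcal C$ is produced by $\mathsf T$ from some graph of $\mathcal D$. -}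

module Defs where

open import Data.Nat using (ℕ; zero; suc)
open import Data.Fin using (Fin; zero; suc; _≟_)
open import Data.Bool using (Bool; true; false; not; _∧_; _∨_; if_then_else_)
open import Data.Product using (Σ; ∃; _×_; _,_)
open import Data.Sum using (_⊎_)
open import Data.Empty using (⊥)
open import Data.List using (List; []; _∷_)
open import Data.List.NonEmpty using (List⁺) renaming (_∷_ to _∷⁺_)
open import Data.Vec.Functional using (Vector) renaming (_∷_ to _∷ᵥ_; [] to []ᵥ)
open import Relation.Nullary.Decidable using (⌊_⌋)
open import Relation.Binary.PropositionalEquality using (_≡_)
open import Function using (_∘_)
open import Level using (0ℓ)

record Graph : Set where
  field
    size : ℕ
    adj  : Fin size → Fin size → Bool
    adj-sym : ∀ u v → adj u v ≡ adj v u
    adj-irr : ∀ u → adj u u ≡ false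
open Graph public

GraphClass : Set₁
GraphClass = Graph → Set

_∪ᶜ_ : GraphClass → GraphClass → GraphClass
(C₁ ∪ᶜ C₂) G = C₁ G ⊎ C₂ G

-- First-order formulas over {E} ∪ Σ, with Σ = Fin s unary symbols,
-- free variables Fin k (de Bruijn; exF binds variable zero).

data Fm (s : ℕ) : ℕ → Set where
  adjF  : ∀ {k} → Fin k → Fin k → Fm s k
  eqF   : ∀ {k} → Fin k → Fin k → Fm s k
  predF : ∀ {k} → Fin s → Fin k → Fm s k
  notF  : ∀ {k} → Fm s k → Fm s k
  andF  : ∀ {k} → Fm s k → Fm s k → Fm s k
  exF   : ∀ {k} → Fm s (suc k) → Fm s k

-- A Σ-expansion of G: one subset of V(G) per unary symbol
Coloring : ℕ → Graph → Set
Coloring s G = Fin s → Fin (size G) → Bool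

anyFin : ∀ {n} → (Fin n → Bool) → Bool
anyFin {zero}  f = false
anyFin {suc n} f = f zero ∨ anyFin (f ∘ suc)

eval : ∀ {s k} (G : Graph) → Coloring s G → Fm s k → Vector (Fin (size G)) k → Bool
eval G c (adjF i j)  ρ = adj G (ρ i) (ρ j)
eval G c (eqF i j)   ρ = ⌊ ρ i ≟ ρ j ⌋
eval G c (predF a i) ρ = c a (ρ i)
eval G c (notF φ)    ρ = not (eval G c φ ρ)
eval G c (andF φ ψ)  ρ = eval G c φ ρ ∧ eval G c ψ ρ
eval G c (exF φ)     ρ = anyFin (λ v → eval G c φ (v ∷ᵥ ρ))

record Interp (s : ℕ) : Set where
  field
    ν : Fm s 1
    η : Fm s 2
    η-sym : ∀ (G : Graph) (c : Coloring s G) u v →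
            eval G c η (u ∷ᵥ v ∷ᵥ []ᵥ) ≡ eval G c η (v ∷ᵥ u ∷ᵥ []ᵥ)
    η-irr : ∀ (G : Graph) (c : Coloring s G) u →
            eval G c η (u ∷ᵥ u ∷ᵥ []ᵥ) ≡ false
open Interp public

IsoToInterp : ∀ {s} → Interp s → (G : Graph) → Coloring s G → Graph → Set
IsoToInterp I G c H =
  Σ (Fin (size H) → Fin (size G)) λ f →
    (∀ i j → f i ≡ f j → i ≡ j) ×
    (∀ i → eval G c (ν I) (f i ∷ᵥ []ᵥ) ≡ true) ×
    (∀ v → eval G c (ν I) (v ∷ᵥ []ᵥ) ≡ true → ∃ λ i → f i ≡ v) ×
    (∀ i j → adj H i j ≡ eval G c (η I) (f i ∷ᵥ f j ∷ᵥ []ᵥ))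

record NonCopying : Set where
  constructor nc
  field
    s  : ℕ
    In : Interp s
open NonCopying public

ProducesNC : NonCopying → Graph → Graph → Set
ProducesNC T G H = Σ (Coloring (s T) G) λ c → IsoToInterp (In T) G c H

copyAdj : (k : ℕ) (G : Graph) → Fin k × Fin (size G) → Fin k × Fin (size G) → Bool
copyAdj k G (a , u) (b , v) =
  if ⌊ u ≟ v ⌋ then not ⌊ a ≟ b ⌋
  else (if ⌊ a ≟ b ⌋ then adj G u v else false)

IsoToCopy : ℕ → Graph → Graph → Set
IsoToCopy k G H =
  Σ (Fin (size H) → Fin k × Fin (size G)) λ f →
    (∀ i j → f i ≡ f j → i ≡ j) ×
    (∀ p → ∃ λ i → f i ≡ p) ×
    (∀ i j → adj H i j ≡ copyAdj k G (f i) (f j))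

data Step : Set where
  copy   : ℕ → Step
  interp : NonCopying → Step

StepProduces : Step → Graph → Graph → Set
StepProduces (copy k)   G H = IsoToCopy k G H
StepProduces (interp T) G H = ProducesNC T G H

Transduction : Set
Transduction = List⁺ Step

-- first step applied first
ProducesL : Step → List Step → Graph → Graph → Set
ProducesL st []           G H = StepProduces st G H
ProducesL st (st′ ∷ sts) G H =
  Σ Graph λ G′ → StepProduces st G G′ × ProducesL st′ sts G′ H

Produces : Transduction → Graph → Graph → Set
Produces (st ∷⁺ sts) = ProducesL st sts

_⊑°_ : GraphClass → GraphClass → Set
C ⊑° D = Σ NonCopying λ T → ∀ H → C H → Σ Graph λ G → D G × ProducesNC T G H

_⊑_ : GraphClass → GraphClass → Set
C ⊑ D = Σ Transduction λ T → ∀ H → C H → Σ Graph λ G → D G × Produces T G H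

IsPartition : GraphClass → GraphClass → GraphClass → Set
IsPartition D D₁ D₂ =
  (∀ G → D₁ G → D G) ×
  (∀ G → D₂ G → D G) ×
  (∀ G → D G → D₁ G ⊎ D₂ G) ×
  (∀ G → D₁ G → D₂ G → ⊥)

-- Put H ∈ D into D₁ when some graph of C₁ produces it, and into D₂ otherwise;
-- a graph of D₂ is then produced by a graph of C₂. Both parts use the given
-- transduction unchanged, so nothing about transductions beyond "produces" matters.
{-# OPTIONS --safe #-}
module Submission where

open import Defs
open import Data.Product using (Σ; _×_; _,_; proj₁; proj₂)
open import Data.Sum using (_⊎_; inj₁; inj₂)
open import Data.Empty using (⊥-elim)
open import Relation.Nullary using (¬_; yes; no)
open import Level using (0ℓ)
open import Axiom.ExcludedMiddle using (ExcludedMiddle)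

ProducedFrom : (Graph → Graph → Set) → GraphClass → GraphClass
ProducedFrom R C H = Σ Graph λ G → C G × R G H

Covers : (Graph → Graph → Set) → GraphClass → GraphClass → Set
Covers R C D = ∀ H → D H → ProducedFrom R C H

module _ (em : ExcludedMiddle 0ℓ) (R : Graph → Graph → Set) (C₁ C₂ D : GraphClass) where

  D-from-C₁ D-rest : GraphClass
  D-from-C₁ H = D H × ProducedFrom R C₁ H
  D-rest    H = D H × ¬ D-from-C₁ H

  D-from-C₁-D-rest-partition : IsPartition D D-from-C₁ D-rest
  D-from-C₁-D-rest-partition =
    (λ _ → proj₁) , (λ _ → proj₁) , split , λ _ d₁ d₂ → proj₂ d₂ d₁
    where
    split : ∀ H → D H → D-from-C₁ H ⊎ D-rest H
    split H d with em {D-from-C₁ H}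
    ... | yes d₁ = inj₁ d₁
    ... | no ¬d₁ = inj₂ (d , ¬d₁)

  D-from-C₁-covered : Covers R C₁ D-from-C₁
  D-from-C₁-covered _ = proj₂

  D-rest-covered : Covers R (C₁ ∪ᶜ C₂) D → Covers R C₂ D-rest
  D-rest-covered cover H (d , ¬d₁) with cover H d
  ... | G , inj₁ c₁ , r = ⊥-elim (¬d₁ (d , G , c₁ , r))
  ... | G , inj₂ c₂ , r = G , c₂ , r

  covers-∪-partition : Covers R (C₁ ∪ᶜ C₂) D →
    Σ GraphClass λ D₁ → Σ GraphClass λ D₂ →
      IsPartition D D₁ D₂ × Covers R C₁ D₁ × Covers R C₂ D₂
  covers-∪-partition cover =
    D-from-C₁ , D-rest , D-from-C₁-D-rest-partition ,
    D-from-C₁-covered , D-rest-covered cover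

-- D ⊑° C and D ⊑ C unfold definitionally to Reduces ProducesNC D C and Reduces Produces D C.
Reduces : {A : Set} → (A → Graph → Graph → Set) → GraphClass → GraphClass → Set
Reduces {A} produces D C = Σ A λ T → Covers (produces T) C D

reduces-∪-partition : ExcludedMiddle 0ℓ → {A : Set} (produces : A → Graph → Graph → Set)
  (C₁ C₂ D : GraphClass) → Reduces produces D (C₁ ∪ᶜ C₂) →
  Σ GraphClass λ D₁ → Σ GraphClass λ D₂ →
    IsPartition D D₁ D₂ × Reduces produces D₁ C₁ × Reduces produces D₂ C₂
reduces-∪-partition em produces C₁ C₂ D (T , cover)
  with covers-∪-partition em (produces T) C₁ C₂ D cover
... | D₁ , D₂ , partition , cover₁ , cover₂ =
  D₁ , D₂ , partition , (T , cover₁) , (T , cover₂)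

fact3p6 : ExcludedMiddle 0ℓ →
    ((C₁ C₂ D : GraphClass) → D ⊑° (C₁ ∪ᶜ C₂) →
      Σ GraphClass λ D₁ → Σ GraphClass λ D₂ →
        IsPartition D D₁ D₂ × (D₁ ⊑° C₁) × (D₂ ⊑° C₂))
    ×
    ((C₁ C₂ D : GraphClass) → D ⊑ (C₁ ∪ᶜ C₂) →
      Σ GraphClass λ D₁ → Σ GraphClass λ D₂ →
        IsPartition D D₁ D₂ × (D₁ ⊑ C₁) × (D₂ ⊑ C₂))
fact3p6 em = reduces-∪-partition em ProducesNC , reduces-∪-partition em Produces
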